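{- Let $(T^{\ast},T^{\otimes})$ be a separated latin bitrade with $\tau_i$ representation $Z=[\tau_1,\tau_2,\tau_3]$ (permutations of $T^{\ast}$). Then the bitrade $(T^{\otimes},T^{\ast})$ (obtained by exchanging the roles of the two partial latin squares) has a $\tau_i$ representation $Z^{ -1}=[\nu_1,\nu_2,\nu_3]$ (permutations of $T^{\otimes}$) which is $\tau$-isomorphic to $[\tau_1^{ -1},\,\tau_2^{ -1},\,\tau_2\tau_1]$; that is, there is a bijection $\theta\colon T^{\otimes}\to T^{\ast}$ with $\theta^{ -1}\nu_1\theta=\tau_1^{ -1}$, $\theta^{ -1}\nu_2\theta=\tau_2^{ -1}$ and $\theta^{ -1}\nu_3\theta=\tau_2\tau_1$.
   Context: Permutations and maps act on the right ($x\mapsto x\pi$) and are composed left to right. A partial latin square is a set $P\subseteq A_1\times A_2\times A_3$ of triples (row, column, symbol) such that any two coordinates of a triple in $P$ determine the third. A (latin) bitrade is a pair $(T^{\ast},T^{\otimes})$ of partial latin squares in $A_1\times A_2\times A_3$ such that (R1) $T^{\ast}\cap T^{\otimes}=\emptyset$; (R2) for every $(a_1,a_2,a_3)\in T^{\ast}$ and all $r\ne s$ in $\{1,2,3\}$ there is a unique $(b_1,b_2,b_3)\in T^{\otimes}$ with $a_r=b_r$, $a_s=b_s$; (R3) the same with the roles of $T^{\ast}$ and $T^{\otimes}$ exchanged. For $r\in\{1,2,3\}$ define $\beta_r\colon T^{\otimes}\to T^{\ast}$ by $(a_1,a_2,a_3)\beta_r=(b_1,b_2,b_3)$ iff $a_r\neq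 b_r$ and $a_i=b_i$ for $i\neq r$ (a bijection). The $\tau_i$ representation of $(T^{\ast},T^{\otimes})$ is $[\tau_1,\tau_2,\tau_3]$ with $\tau_1=\beta_2^{ -1}\beta_3$, $\tau_2=\beta_3^{ -1}\beta_1$, $\tau_3=\beta_1^{ -1}\beta_2$, permutations of $T^{\ast}$; for the bitrade $(T^{\otimes},T^{\ast})$ the same definition is applied with $T^{\ast}$ and $T^{\otimes}$ interchanged. The bitrade is separated if each row, each column and each symbol corresponds bijectively to a cycle of $\tau_1$, $\tau_2$, $\tau_3$ respectively. Two triples $[\tau_1,\tau_2,\tau_3]$ on $\Gamma$ and $[\nu_1,\nu_2,\nu_3]$ on $\Gamma'$ are $\tau$-isomorphic if there is a bijection $\theta\colon\Gamma'\to\Gamma$ with $\theta^{ -1}\nu_i\theta=\tau_i$ for all $i$. -}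

module Defs where

open import Data.Nat using (ℕ; zero; suc)
open import Data.Product using (Σ; ∃; ∃!; _×_; _,_; proj₁; proj₂)
open import Data.List using (List)
open import Data.List.Membership.Propositional using (_∈_)
open import Relation.Binary.PropositionalEquality using (_≡_; _≢_)
open import Relation.Nullary using (¬_)
open import Data.Empty using (⊥)

data Coord : Set where
  c₁ c₂ c₃ : Coord

module _ {A₁ A₂ A₃ : Set} where

  Triple : Set
  Triple = A₁ × A₂ × A₃

  row : Triple → A₁
  row (a , _ , _) = a

  col : Triple → A₂
  col (_ , b , _) = b

  sym : Triple → A₃
  sym (_ , _ , c) = c

  Same : Coord → Triple → Triple → Set
  Same c₁ t u = row t ≡ row u
  Same c₂ t u = col t ≡ col u
  Same c₃ t u = sym t ≡ sym u

  Finite : (Triple → Set) → Set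
  Finite P = ∃ λ (xs : List Triple) → ∀ t → P t → t ∈ xs

  PartialLatinSquare : (Triple → Set) → Set
  PartialLatinSquare P =
    Finite P ×
    (∀ r s → r ≢ s → ∀ t u → P t → P u → Same r t u → Same s t u → t ≡ u)

  Cover : (Triple → Set) → (Triple → Set) → Set
  Cover S T = ∀ t → S t → ∀ r s → r ≢ s →
              ∃! _≡_ (λ u → T u × Same r t u × Same s t u)

  record Bitrade (S T : Triple → Set) : Set where
    field
      plsS  : PartialLatinSquare S
      plsT  : PartialLatinSquare T
      disj  : ∀ t → S t → T t → ⊥          -- (R1)
      coverST : Cover S T                   -- (R2)
      coverTS : Cover T S                   -- (R3)

  swap : ∀ {S T} → Bitrade S T → Bitrade T S
  swap b = record
    { plsS = Bitrade.plsT b ; plsT = Bitrade.plsS b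
    ; disj = λ t x y → Bitrade.disj b t y x
    ; coverST = Bitrade.coverTS b ; coverTS = Bitrade.coverST b }

  Elt : (Triple → Set) → Set
  Elt P = Σ Triple P

  _≈_ : ∀ {P} → Elt P → Elt P → Set
  x ≈ y = proj₁ x ≡ proj₁ y

  c₁≢c₂ : c₁ ≢ c₂
  c₁≢c₂ ()
  c₁≢c₃ : c₁ ≢ c₃
  c₁≢c₃ ()
  c₂≢c₃ : c₂ ≢ c₃
  c₂≢c₃ ()

  other : ∀ {S T} → Cover S T → Coord → Elt S → Elt T
  other cov c₁ (t , p) with cov t p c₂ c₃ c₂≢c₃
  ... | u , (q , _) , _ = u , q
  other cov c₂ (t , p) with cov t p c₁ c₃ c₁≢c₃
  ... | u , (q , _) , _ = u , q
  other cov c₃ (t , p) with cov t p c₁ c₂ c₁≢c₂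
  ... | u , (q , _) , _ = u , q

  -- β_r : T⊗ → T* for the bitrade (T* , T⊗) = (S , T):
  -- (a)β_r = b iff a_r ≠ b_r and a_i = b_i (i ≠ r); by (R1) this is the
  -- unique b ∈ T* agreeing with a off coordinate r, provided by (R3).
  β : ∀ {S T} → Bitrade S T → Coord → Elt T → Elt S
  β b r = other (Bitrade.coverTS b) r

  β⁻¹ : ∀ {S T} → Bitrade S T → Coord → Elt S → Elt T
  β⁻¹ b r = other (Bitrade.coverST b) r

  -- τ_i representation (maps act on the right, composed left to right):
  -- τ₁ = β₂⁻¹β₃, τ₂ = β₃⁻¹β₁, τ₃ = β₁⁻¹β₂ ;  x(β₂⁻¹β₃) = (x β₂⁻¹) β₃.
  τ : ∀ {S T} → Bitrade S T → Coord → Elt S → Elt S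
  τ b c₁ x = β b c₃ (β⁻¹ b c₂ x)
  τ b c₂ x = β b c₁ (β⁻¹ b c₃ x)
  τ b c₃ x = β b c₂ (β⁻¹ b c₁ x)

  iter : ∀ {X : Set} → (X → X) → ℕ → X → X
  iter f zero x = x
  iter f (suc k) x = iter f k (f x)

  SameCycle : ∀ {P} → (Elt P → Elt P) → Elt P → Elt P → Set
  SameCycle f x y = ∃ λ k → iter f k x ≈ y

  Separated : ∀ {S T} → Bitrade S T → Set
  Separated {S} b = ∀ r (x y : Elt S) →
    (Same r (proj₁ x) (proj₁ y) → SameCycle (τ b r) x y) ×
    (SameCycle (τ b r) x y → Same r (proj₁ x) (proj₁ y))

  record EltBijection {P Q} (θ : Elt Q → Elt P) (θ⁻¹ : Elt P → Elt Q) : Set where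
    field
      cong-θ   : ∀ {x y} → x ≈ y → θ x ≈ θ y
      cong-θ⁻¹ : ∀ {x y} → x ≈ y → θ⁻¹ x ≈ θ⁻¹ y
      left     : ∀ x → θ⁻¹ (θ x) ≈ x
      right    : ∀ x → θ (θ⁻¹ x) ≈ x

-- The inverse bitrade (T⊗, T*) has τ_i representation [ν₁, ν₂, ν₃] with
-- ν₁ = β₂β₃⁻¹, ν₂ = β₃β₁⁻¹, ν₃ = β₁β₂⁻¹ (permutations of T⊗), because
-- exchanging the two partial latin squares exchanges β_r with β_r⁻¹.
-- Taking θ = β₃ : T⊗ → T*, the identities follow by cancelling β_r
-- against β_r⁻¹:
--   θ⁻¹ν₁θ = β₃⁻¹β₂β₃⁻¹β₃ = β₃⁻¹β₂ = τ₁⁻¹,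
--   θ⁻¹ν₂θ = β₃⁻¹β₃β₁⁻¹β₃ = β₁⁻¹β₃ = τ₂⁻¹,
--   θ⁻¹ν₃θ = β₃⁻¹β₁β₂⁻¹β₃ = τ₂τ₁   (definitionally).
-- So the only real content is that β_r and β_r⁻¹ are mutually inverse
-- maps that respect equality of triples.
module Submission where

open import Defs
open import Data.Product using (Σ; ∃; ∃-syntax; _×_; _,_; proj₁; proj₂)
open import Relation.Binary.PropositionalEquality as P using (_≡_; refl)

module _ {A₁ A₂ A₃ : Set} where
  private
    Tr = Triple {A₁} {A₂} {A₃}

  Off : Coord → Tr → Tr → Set
  Off c₁ t u = Same c₂ t u × Same c₃ t u
  Off c₂ t u = Same c₁ t u × Same c₃ t u
  Off c₃ t u = Same c₁ t u × Same c₂ t u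

  off-sym : ∀ r {t u : Tr} → Off r t u → Off r u t
  off-sym c₁ (e , f) = P.sym e , P.sym f
  off-sym c₂ (e , f) = P.sym e , P.sym f
  off-sym c₃ (e , f) = P.sym e , P.sym f

  module _ {S T : Tr → Set} (cov : Cover S T) where

    other-agrees : ∀ r (x : Elt S) → Off r (proj₁ x) (proj₁ (other cov r x))
    other-agrees c₁ (t , p) = proj₂ (proj₁ (proj₂ (cov t p c₂ c₃ (c₂≢c₃ {A₁} {A₂} {A₃}))))
    other-agrees c₂ (t , p) = proj₂ (proj₁ (proj₂ (cov t p c₁ c₃ (c₁≢c₃ {A₁} {A₂} {A₃}))))
    other-agrees c₃ (t , p) = proj₂ (proj₁ (proj₂ (cov t p c₁ c₂ (c₁≢c₂ {A₁} {A₂} {A₃}))))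

    other-unique : ∀ r (x : Elt S) (u : Elt T) → Off r (proj₁ x) (proj₁ u) →
                   other cov r x ≈ u
    other-unique c₁ (t , p) (u , q) (e , f) = proj₂ (proj₂ (cov t p c₂ c₃ (c₂≢c₃ {A₁} {A₂} {A₃}))) (q , e , f)
    other-unique c₂ (t , p) (u , q) (e , f) = proj₂ (proj₂ (cov t p c₁ c₃ (c₁≢c₃ {A₁} {A₂} {A₃}))) (q , e , f)
    other-unique c₃ (t , p) (u , q) (e , f) = proj₂ (proj₂ (cov t p c₁ c₂ (c₁≢c₂ {A₁} {A₂} {A₃}))) (q , e , f)

    other-cong : ∀ r {x y : Elt S} → x ≈ y → other cov r x ≈ other cov r y
    other-cong r {x} {y} refl = P.sym (other-unique r y (other cov r x) (other-agrees r x))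

  other-cancel : ∀ {S T : Tr → Set} (cov : Cover S T) (cov' : Cover T S) r (x : Elt S) →
                 other cov' r (other cov r x) ≈ x
  other-cancel cov cov' r x =
    other-unique cov' r (other cov r x) x (off-sym r (other-agrees cov r x))

  module _ {S T : Tr → Set} (b : Bitrade S T) where

    β-cong : ∀ r {x y : Elt T} → x ≈ y → β b r x ≈ β b r y
    β-cong = other-cong (Bitrade.coverTS b)

    β⁻¹-cong : ∀ r {x y : Elt S} → x ≈ y → β⁻¹ b r x ≈ β⁻¹ b r y
    β⁻¹-cong = other-cong (Bitrade.coverST b)

    β-β⁻¹ : ∀ r (x : Elt S) → β b r (β⁻¹ b r x) ≈ x
    β-β⁻¹ = other-cancel (Bitrade.coverST b) (Bitrade.coverTS b)

    β⁻¹-β : ∀ r (y : Elt T) → β⁻¹ b r (β b r y) ≈ y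
    β⁻¹-β = other-cancel (Bitrade.coverTS b) (Bitrade.coverST b)

    β₃-bijection : EltBijection {P = S} {Q = T} (β b c₃) (β⁻¹ b c₃)
    β₃-bijection = record
      { cong-θ = β-cong c₃ ; cong-θ⁻¹ = β⁻¹-cong c₃
      ; left = β⁻¹-β c₃ ; right = β-β⁻¹ c₃ }

    -- In the swapped bitrade β_r and β_r⁻¹ exchange roles, so (unfolding)
    -- x τ₁ θ⁻¹ ν₁ θ = x β₂⁻¹β₃ · β₃⁻¹ · β₂β₃⁻¹ · β₃, which collapses to x.
    conj-ν₁ : ∀ x → β b c₃ (τ (swap b) c₁ (β⁻¹ b c₃ (τ b c₁ x))) ≈ x
    conj-ν₁ x =
      P.trans (β-β⁻¹ c₃ (β b c₂ (β⁻¹ b c₃ (β b c₃ y))))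
      (P.trans (β-cong c₂ {β⁻¹ b c₃ (β b c₃ y)} {y} (β⁻¹-β c₃ y))
               (β-β⁻¹ c₂ x))
      where y = β⁻¹ b c₂ x

    -- x τ₂ θ⁻¹ ν₂ θ = x β₃⁻¹β₁ · β₃⁻¹ · β₃β₁⁻¹ · β₃, which collapses to x.
    conj-ν₂ : ∀ x → β b c₃ (τ (swap b) c₂ (β⁻¹ b c₃ (τ b c₂ x))) ≈ x
    conj-ν₂ x =
      P.trans (β-cong c₃ {β⁻¹ b c₁ (β b c₃ (β⁻¹ b c₃ y))} {β⁻¹ b c₁ y}
                (β⁻¹-cong c₁ {β b c₃ (β⁻¹ b c₃ y)} {y} (β-β⁻¹ c₃ y)))
      (P.trans (β-cong c₃ {β⁻¹ b c₁ y} {β⁻¹ b c₃ x} (β⁻¹-β c₁ (β⁻¹ b c₃ x)))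
               (β-β⁻¹ c₃ x))
      where y = β b c₁ (β⁻¹ b c₃ x)

mainTheorem1 : {A₁ A₂ A₃ : Set} (T* T⊗ : Triple {A₁} {A₂} {A₃} → Set)
    (b : Bitrade T* T⊗) → Separated b →
    ∃[ θ ] ∃[ θ⁻¹ ] (EltBijection {P = T*} {Q = T⊗} θ θ⁻¹ ×
    (∀ x → θ (τ (swap b) c₁ (θ⁻¹ (τ b c₁ x))) ≈ x) ×
    (∀ x → θ (τ (swap b) c₂ (θ⁻¹ (τ b c₂ x))) ≈ x) ×
    (∀ x → θ (τ (swap b) c₃ (θ⁻¹ x)) ≈ τ b c₁ (τ b c₂ x)))
mainTheorem1 T* T⊗ b _ =
  β b c₃ , β⁻¹ b c₃ , β₃-bijection b ,
  conj-ν₁ b , conj-ν₂ b ,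
  (λ x → refl)
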